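{- Let $G$ and $H$ be finite simple graphs. If the Cartesian product $G \,\square\, H$ is well-covered, then at least one of $G$ or $H$ is well-covered.
   Context: A graph is well-covered if every maximal independent set of vertices has the same cardinality. The Cartesian product $G\,\square\, H$ has vertex set $V(G)\times V(H)$, with $(x_1,x_2)$ adjacent to $(y_1,y_2)$ if either $x_1=y_1$ and $x_2y_2\in E(H)$, or $x_1y_1\in E(G)$ and $x_2=y_2$. -}

module Defs where

open import Data.Nat using (ℕ; _*_)
open import Data.Bool using (Bool; true; false)
open import Data.Fin using (Fin; remQuot)
open import Data.Fin.Subset using (Subset; _∈_; _∉_; ∣_∣; _∪_; ⁅_⁆)
open import Data.Product using (_×_; _,_; proj₁; proj₂)
open import Relation.Binary.PropositionalEquality using (_≡_; _≢_; refl; cong₂)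
open import Relation.Nullary using (¬_)

record Graph (n : ℕ) : Set where
  field
    adj   : Fin n → Fin n → Bool
    sym   : ∀ x y → adj x y ≡ adj y x
    irref : ∀ x → adj x x ≡ false
open Graph public

Adj : ∀ {n} → Graph n → Fin n → Fin n → Set
Adj G x y = adj G x y ≡ true

Independent : ∀ {n} → Graph n → Subset n → Set
Independent G S = ∀ x y → x ∈ S → y ∈ S → ¬ Adj G x y

MaximalIndependent : ∀ {n} → Graph n → Subset n → Set
MaximalIndependent G S =
  Independent G S × (∀ v → v ∉ S → ¬ Independent G (S ∪ ⁅ v ⁆))

WellCovered : ∀ {n} → Graph n → Set
WellCovered G = ∀ S T → MaximalIndependent G S → MaximalIndependent G T → ∣ S ∣ ≡ ∣ T ∣

private
  _∧_ : Bool → Bool → Bool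
  true ∧ b = b
  false ∧ _ = false

  _∨_ : Bool → Bool → Bool
  true ∨ _ = true
  false ∨ b = b

  eqF : ∀ {n} → Fin n → Fin n → Bool
  eqF Fin.zero Fin.zero = true
  eqF Fin.zero (Fin.suc _) = false
  eqF (Fin.suc _) Fin.zero = false
  eqF (Fin.suc i) (Fin.suc j) = eqF i j

  eqF-sym : ∀ {n} (i j : Fin n) → eqF i j ≡ eqF j i
  eqF-sym Fin.zero Fin.zero = refl
  eqF-sym Fin.zero (Fin.suc _) = refl
  eqF-sym (Fin.suc _) Fin.zero = refl
  eqF-sym (Fin.suc i) (Fin.suc j) = eqF-sym i j

  eqF-refl : ∀ {n} (i : Fin n) → eqF i i ≡ true
  eqF-refl Fin.zero = refl
  eqF-refl (Fin.suc i) = eqF-refl i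

-- Vertex set V(G) × V(H) is encoded as Fin (n * m)
-- via the standard bijection remQuot : Fin (n * m) → Fin n × Fin m.
-- (x1,x2) ~ (y1,y2) iff (x1 = y1 and x2 y2 ∈ E(H)) or (x1 y1 ∈ E(G) and x2 = y2).
prodAdj' : ∀ {n m} → Graph n → Graph m → Fin n × Fin m → Fin n × Fin m → Bool
prodAdj' G H (x1 , x2) (y1 , y2) = (eqF x1 y1 ∧ adj H x2 y2) ∨ (adj G x1 y1 ∧ eqF x2 y2)

prodAdj : ∀ {n m} → Graph n → Graph m → Fin (n * m) → Fin (n * m) → Bool
prodAdj {n} {m} G H u v = prodAdj' G H (remQuot {n} m u) (remQuot {n} m v)

private
  prodAdj'-sym : ∀ {n m} (G : Graph n) (H : Graph m) p q → prodAdj' G H p q ≡ prodAdj' G H q p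
  prodAdj'-sym G H (x1 , x2) (y1 , y2) =
    cong₂ _∨_ (cong₂ _∧_ (eqF-sym x1 y1) (sym H x2 y2)) (cong₂ _∧_ (sym G x1 y1) (eqF-sym x2 y2))

  prodAdj'-irref : ∀ {n m} (G : Graph n) (H : Graph m) p → prodAdj' G H p p ≡ false
  prodAdj'-irref G H (x1 , x2) rewrite eqF-refl x1 | irref H x2 | irref G x1 = refl

_□_ : ∀ {n m} → Graph n → Graph m → Graph (n * m)
adj   (_□_ {n} {m} G H) = prodAdj G H
sym   (_□_ {n} {m} G H) u v = prodAdj'-sym G H (remQuot {n} m u) (remQuot {n} m v)
irref (_□_ {n} {m} G H) u = prodAdj'-irref G H (remQuot {n} m u)

module Submission where

-- Suppose neither is.  A pair of maximal independent sets of different sizes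
-- in a graph can be improved by an exchange argument until it is either a
-- "star" (a maximal I and p ∈ I such that every neighbour of p has another
-- neighbour in I) or a disjoint pair.  In the product, sets built row by row
-- from these witnesses give independent Z₁, Z₂ with ∣ Z₁ ∣ < ∣ Z₂ ∣ such that
-- every vertex dominated by Z₂ is dominated by Z₁; the domination criterion
-- then produces maximal independent sets of different sizes in G □ H.

open import Defs
open import Data.Nat using (ℕ; zero; suc; _+_; _*_; _∸_; _≤_; _<_; z≤n; s≤s)
open import Data.Nat.Solver using (module +-*-Solver)
open import Data.Nat.Properties
  using (≤-trans; <-≤-trans; ≤-pred; <-irrefl; _<?_; <-cmp; +-suc; +-assoc; +-comm; m≤m+n; 1+n≰n;
         +-monoˡ-<; *-monoʳ-<; +-identityʳ; m+[n∸m]≡n; m<m+n; +-*-semiring; module ≤-Reasoning)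
open import Data.Bool using (Bool; true; false) renaming (_≟_ to _≟ᵇ_)
open import Data.Fin using (Fin; zero; suc; _↑ˡ_; _↑ʳ_; combine; remQuot)
open import Data.Fin.Properties using (all?; any?; ¬∀⟶∃¬; remQuot-combine) renaming (_≟_ to _≟ᶠ_)
open import Data.Fin.Subset using (Subset; _∈_; _∉_; _⊆_; _⊂_; ∣_∣; _∪_; _∩_; _─_; _-_; ⁅_⁆; ⊥; inside; outside)
open import Data.Fin.Subset.Properties
  using (_∈?_; anySubset?; ∉⊥; x∈p∪q⁺; x∈p∪q⁻; x∈p∩q⁺; x∈p∩q⁻; x∈⁅x⁆; x∈⁅y⁆⇒x≡y; x∉⁅y⁆⇒x≢y;
         x∈p∧x∉q⇒x∈p─q; x∈p∧x≢y⇒x∈p-y; p─q⊆p; p⊆q⇒∣p∣≤∣q∣; p⊂q⇒∣p∣<∣q∣; ∣p∣≤n; ∣⁅x⁆∣≡1; ∣⊥∣≡0)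
open import Data.Vec using ([]; _∷_; tabulate; lookup; here; there)
open import Data.Vec.Properties using (tabulate∘lookup; lookup∘tabulate; lookup⇒[]=; []=⇒lookup)
open import Data.Product using (∃-syntax; _×_; _,_; proj₁; proj₂)
open import Data.Sum using (_⊎_; inj₁; inj₂)
open import Function using (_∘_)
open import Relation.Nullary using (¬_; Dec; yes; no; ¬?; contradiction)
open import Relation.Nullary.Decidable using (_×-dec_; _→-dec_)
open import Relation.Binary.Definitions using (tri<; tri≈; tri>)
open import Relation.Binary.PropositionalEquality
  using (_≡_; _≢_; refl; trans; cong; cong₂; subst; subst₂; module ≡-Reasoning) renaming (sym to ≡-sym)
open import Algebra.Properties.Semiring.Sum +-*-semiring
  using (sum; sum-cong-≗; ∑-comm; ∑-distrib-+; *-distribʳ-sum)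

indicator : Bool → ℕ
indicator true  = 1
indicator false = 0

count : ∀ {k} → (Fin k → Bool) → ℕ
count f = sum (λ x → indicator (f x))

∣tabulate∣ : ∀ {k} (f : Fin k → Bool) → ∣ tabulate f ∣ ≡ count f
∣tabulate∣ {zero}  f = refl
∣tabulate∣ {suc k} f with f zero
... | true  = cong suc (∣tabulate∣ (f ∘ suc))
... | false = ∣tabulate∣ (f ∘ suc)

∣p∣≡count : ∀ {k} (p : Subset k) → ∣ p ∣ ≡ count (lookup p)
∣p∣≡count p = trans (cong ∣_∣ (≡-sym (tabulate∘lookup p))) (∣tabulate∣ (lookup p))

count-↑ : ∀ a {b} (f : Fin (a + b) → Bool) → count f ≡ count (f ∘ (_↑ˡ b)) + count (f ∘ (a ↑ʳ_))
count-↑ zero    f = refl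
count-↑ (suc a) {b} f = trans (cong (indicator (f zero) +_) (count-↑ a (f ∘ suc)))
  (≡-sym (+-assoc (indicator (f zero)) (count (f ∘ suc ∘ (_↑ˡ b))) (count (f ∘ suc ∘ (a ↑ʳ_)))))

count-combine : ∀ n m (f : Fin (n * m) → Bool) → count f ≡ sum {n} (λ g → count {m} (λ h → f (combine g h)))
count-combine zero    m f = refl
count-combine (suc n) m f =
  trans (count-↑ m f) (cong (count (f ∘ (_↑ˡ (n * m))) +_) (count-combine n m (f ∘ (m ↑ʳ_))))

∣p∪q∣≡∣p∣+∣q∣ : ∀ {n} (p q : Subset n) → (∀ {x} → x ∈ p → x ∉ q) → ∣ p ∪ q ∣ ≡ ∣ p ∣ + ∣ q ∣
∣p∪q∣≡∣p∣+∣q∣ []            []            _        = refl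
∣p∪q∣≡∣p∣+∣q∣ (inside  ∷ p) (inside  ∷ q) disjoint = contradiction here (disjoint here)
∣p∪q∣≡∣p∣+∣q∣ (inside  ∷ p) (outside ∷ q) disjoint =
  cong suc (∣p∪q∣≡∣p∣+∣q∣ p q (λ x∈p x∈q → disjoint (there x∈p) (there x∈q)))
∣p∪q∣≡∣p∣+∣q∣ (outside ∷ p) (inside  ∷ q) disjoint =
  trans (cong suc (∣p∪q∣≡∣p∣+∣q∣ p q (λ x∈p x∈q → disjoint (there x∈p) (there x∈q))))
        (≡-sym (+-suc ∣ p ∣ ∣ q ∣))
∣p∪q∣≡∣p∣+∣q∣ (outside ∷ p) (outside ∷ q) disjoint =
  ∣p∪q∣≡∣p∣+∣q∣ p q (λ x∈p x∈q → disjoint (there x∈p) (there x∈q))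

lookup-∉ : ∀ {n} {x : Fin n} {p : Subset n} → x ∉ p → lookup p x ≡ outside
lookup-∉ {x = x} {p} x∉p with lookup p x in e
... | inside  = contradiction (lookup⇒[]= x p e) x∉p
... | outside = refl

x∈p─q⇒x∉q : ∀ {n} {x : Fin n} (p q : Subset n) → x ∈ p ─ q → x ∉ q
x∈p─q⇒x∉q (inside  ∷ p) (outside ∷ q) here      = λ ()
x∈p─q⇒x∉q {x = zero} (outside ∷ p) (outside ∷ q) ()
x∈p─q⇒x∉q {x = zero} (_       ∷ p) (inside  ∷ q) ()
x∈p─q⇒x∉q (_       ∷ p) (_       ∷ q) (there m) = λ { (there m′) → x∈p─q⇒x∉q p q m m′ }

-- Rearrangement inequality for two pairs: matching the larger factors
-- together gives the larger sum, since the difference is (b - a)(d - c) > 0.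
rearrangement : ∀ {a b c d} → a < b → c < d → a * d + b * c < a * c + b * d
rearrangement {a} {b} {c} {d} a<b c<d = subst₂ (λ b d → a * d + b * c < a * c + b * d) b≡ d≡ strict
  where
  open +-*-Solver
  x = b ∸ suc a
  y = d ∸ suc c
  b≡ : a + suc x ≡ b
  b≡ = trans (+-suc a x) (m+[n∸m]≡n a<b)
  d≡ : c + suc y ≡ d
  d≡ = trans (+-suc c y) (m+[n∸m]≡n c<d)
  expand : ∀ a x c y → a * c + (a + x) * (c + y) ≡ (a * (c + y) + (a + x) * c) + x * y
  expand = solve 4 (λ a x c y → a :* c :+ (a :+ x) :* (c :+ y)
                              := (a :* (c :+ y) :+ (a :+ x) :* c) :+ x :* y) refl
  strict : a * (c + suc y) + (a + suc x) * c < a * c + (a + suc x) * (c + suc y)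
  strict = subst (a * (c + suc y) + (a + suc x) * c <_) (≡-sym (expand a (suc x) c (suc y))) (m<m+n _ (s≤s z≤n))

module _ {k : ℕ} (G : Graph k) where

  adj-sym : ∀ {x y} → Adj G x y → Adj G y x
  adj-sym {x} {y} xy = trans (sym G y x) xy

  adj-irrefl : ∀ {x} → ¬ Adj G x x
  adj-irrefl {x} xx = contradiction (trans (≡-sym xx) (irref G x)) λ ()

  Adj? : ∀ x y → Dec (Adj G x y)
  Adj? x y = adj G x y ≟ᵇ true

  independent? : ∀ S → Dec (Independent G S)
  independent? S = all? λ x → all? λ y → (x ∈? S) →-dec ((y ∈? S) →-dec ¬? (Adj? x y))

  maximal? : ∀ S → Dec (MaximalIndependent G S)
  maximal? S = independent? S ×-dec all? λ v → ¬? (v ∈? S) →-dec ¬? (independent? (S ∪ ⁅ v ⁆))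

  independent-⊆ : ∀ {S T} → S ⊆ T → Independent G T → Independent G S
  independent-⊆ S⊆T indT x y x∈S y∈S = indT x y (S⊆T x∈S) (S⊆T y∈S)

  independent-⁅⁆ : ∀ v → Independent G ⁅ v ⁆
  independent-⁅⁆ v x y x∈ y∈ with x∈⁅y⁆⇒x≡y v x∈ | x∈⁅y⁆⇒x≡y v y∈
  ... | refl | refl = adj-irrefl

  ∪-independent : ∀ {S T} → Independent G S → Independent G T →
                  (∀ x y → x ∈ S → y ∈ T → ¬ Adj G x y) → Independent G (S ∪ T)
  ∪-independent {S} {T} indS indT cross x y x∈ y∈ with x∈p∪q⁻ S T x∈ | x∈p∪q⁻ S T y∈
  ... | inj₁ x∈S | inj₁ y∈S = indS x y x∈S y∈S
  ... | inj₂ x∈T | inj₂ y∈T = indT x y x∈T y∈T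
  ... | inj₁ x∈S | inj₂ y∈T = cross x y x∈S y∈T
  ... | inj₂ x∈T | inj₁ y∈S = cross y x y∈S x∈T ∘ adj-sym

  Covered : Subset k → Fin k → Set
  Covered S v = v ∈ S ⊎ ∃[ z ] z ∈ S × Adj G v z

  maximal⇒covers : ∀ {S} → MaximalIndependent G S → ∀ v → Covered S v
  maximal⇒covers {S} (indS , maxS) v with v ∈? S | any? (λ z → (z ∈? S) ×-dec Adj? v z)
  ... | yes v∈S | _           = inj₁ v∈S
  ... | no _    | yes nbr     = inj₂ nbr
  ... | no v∉S  | no noNbr    = contradiction (∪-independent indS (independent-⁅⁆ v) noEdge) (maxS v v∉S)
    where
    noEdge : ∀ x y → x ∈ S → y ∈ ⁅ v ⁆ → ¬ Adj G x y
    noEdge x y x∈S y∈⁅v⁆ xy with x∈⁅y⁆⇒x≡y v y∈⁅v⁆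
    ... | refl = noNbr (x , x∈S , adj-sym xy)

  -- Greedy extension of an independent set to a maximal one.  Each step
  -- enlarges the set, so `fuel` with k ≤ fuel + ∣ S ∣ steps suffice.
  extendWithin : ∀ fuel S → k ≤ fuel + ∣ S ∣ → Independent G S →
                 ∃[ M ] MaximalIndependent G M × S ⊆ M
  extendWithin fuel S bound indS with any? (λ v → ¬? (v ∈? S) ×-dec independent? (S ∪ ⁅ v ⁆))
  ... | no cannotGrow = S , (indS , λ v v∉S indSv → cannotGrow (v , v∉S , indSv)) , λ x∈S → x∈S
  ... | yes (v , v∉S , indSv) = grow fuel bound
    where
    grown : ∣ S ∪ ⁅ v ⁆ ∣ ≡ suc ∣ S ∣
    grown = begin
      ∣ S ∪ ⁅ v ⁆ ∣      ≡⟨ ∣p∪q∣≡∣p∣+∣q∣ S ⁅ v ⁆ (λ x∈S x∈⁅v⁆ → v∉S (subst (_∈ S) (x∈⁅y⁆⇒x≡y v x∈⁅v⁆) x∈S)) ⟩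
      ∣ S ∣ + ∣ ⁅ v ⁆ ∣  ≡⟨ cong (∣ S ∣ +_) (∣⁅x⁆∣≡1 v) ⟩
      ∣ S ∣ + 1          ≡⟨ +-comm ∣ S ∣ 1 ⟩
      suc ∣ S ∣          ∎
      where open ≡-Reasoning
    grow : ∀ fuel → k ≤ fuel + ∣ S ∣ → ∃[ M ] MaximalIndependent G M × S ⊆ M
    grow zero        bound = contradiction (≤-trans (subst (_≤ k) grown (∣p∣≤n (S ∪ ⁅ v ⁆))) bound) 1+n≰n
    grow (suc fuel′) bound with extendWithin fuel′ (S ∪ ⁅ v ⁆) bound′ indSv
      where bound′ = subst (k ≤_) (trans (≡-sym (+-suc fuel′ ∣ S ∣)) (cong (fuel′ +_) (≡-sym grown))) bound
    ... | M , maxM , S∪v⊆M = M , maxM , S∪v⊆M ∘ x∈p∪q⁺ ∘ inj₁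

  extend : ∀ {S} → Independent G S → ∃[ M ] MaximalIndependent G M × S ⊆ M
  extend {S} = extendWithin k S (m≤m+n k ∣ S ∣)
  -- If Z₁, Z₂ are independent, every vertex dominated
  -- by Z₂ is dominated by Z₁, and ∣ Z₁ ∣ < ∣ Z₂ ∣, then G is not well-covered:
  -- extend Z₁ to a maximal M₁; the part W = M₁ ─ Z₁ is undominated by Z₁,
  -- hence by Z₂, so Z₂ ∪ W is independent and extends to a maximal M₂ with
  -- ∣ M₂ ∣ ≥ ∣ Z₂ ∣ + ∣ W ∣ > ∣ Z₁ ∣ + ∣ W ∣ = ∣ M₁ ∣.
  dominationCriterion : ∀ {Z₁ Z₂} → Independent G Z₁ → Independent G Z₂ →
                        (∀ v → Covered Z₂ v → Covered Z₁ v) → ∣ Z₁ ∣ < ∣ Z₂ ∣ → ¬ WellCovered G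
  dominationCriterion {Z₁} {Z₂} indZ₁ indZ₂ dominated smaller wc =
    <-irrefl (wc M₁ M₂ maxM₁ maxM₂) M₁<M₂
    where
    M₁ = proj₁ (extend indZ₁)
    maxM₁ = proj₁ (proj₂ (extend indZ₁))
    Z₁⊆M₁ = proj₂ (proj₂ (extend indZ₁))
    W = M₁ ─ Z₁

    W-uncovered : ∀ {w} → w ∈ W → ¬ Covered Z₁ w
    W-uncovered w∈W (inj₁ w∈Z₁)            = x∈p─q⇒x∉q M₁ Z₁ w∈W w∈Z₁
    W-uncovered w∈W (inj₂ (z , z∈Z₁ , wz)) = proj₁ maxM₁ _ z (p─q⊆p M₁ Z₁ w∈W) (Z₁⊆M₁ z∈Z₁) wz

    Z₂∩W-empty : ∀ {x} → x ∈ Z₂ → x ∉ W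
    Z₂∩W-empty x∈Z₂ x∈W = W-uncovered x∈W (dominated _ (inj₁ x∈Z₂))

    indT : Independent G (Z₂ ∪ W)
    indT = ∪-independent indZ₂ (independent-⊆ (p─q⊆p M₁ Z₁) (proj₁ maxM₁))
             (λ x w x∈Z₂ w∈W xw → W-uncovered w∈W (dominated w (inj₂ (x , x∈Z₂ , adj-sym xw))))

    M₂ = proj₁ (extend indT)
    maxM₂ = proj₁ (proj₂ (extend indT))
    T⊆M₂ = proj₂ (proj₂ (extend indT))

    M₁⊆Z₁∪W : M₁ ⊆ Z₁ ∪ W
    M₁⊆Z₁∪W {x} x∈M₁ with x ∈? Z₁
    ... | yes x∈Z₁ = x∈p∪q⁺ (inj₁ x∈Z₁)
    ... | no  x∉Z₁ = x∈p∪q⁺ (inj₂ (x∈p∧x∉q⇒x∈p─q x∈M₁ x∉Z₁))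

    M₁<M₂ : ∣ M₁ ∣ < ∣ M₂ ∣
    M₁<M₂ = begin-strict
      ∣ M₁ ∣           ≤⟨ p⊆q⇒∣p∣≤∣q∣ M₁⊆Z₁∪W ⟩
      ∣ Z₁ ∪ W ∣       ≡⟨ ∣p∪q∣≡∣p∣+∣q∣ Z₁ W (λ x∈Z₁ x∈W → x∈p─q⇒x∉q M₁ Z₁ x∈W x∈Z₁) ⟩
      ∣ Z₁ ∣ + ∣ W ∣   <⟨ +-monoˡ-< ∣ W ∣ smaller ⟩
      ∣ Z₂ ∣ + ∣ W ∣   ≡⟨ ∣p∪q∣≡∣p∣+∣q∣ Z₂ W Z₂∩W-empty ⟨
      ∣ Z₂ ∪ W ∣       ≤⟨ p⊆q⇒∣p∣≤∣q∣ T⊆M₂ ⟩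
      ∣ M₂ ∣           ∎
      where open ≤-Reasoning

  record Unbalanced : Set where
    constructor unbalanced
    field
      {small large}  : Subset k
      small-maximal  : MaximalIndependent G small
      large-maximal  : MaximalIndependent G large
      small<large    : ∣ small ∣ < ∣ large ∣

  wellCovered⊎unbalanced : WellCovered G ⊎ Unbalanced
  wellCovered⊎unbalanced
    with anySubset? (λ A → anySubset? (λ B → maximal? A ×-dec maximal? B ×-dec (∣ A ∣ <? ∣ B ∣)))
  ... | yes (A , B , maxA , maxB , A<B) = inj₂ (unbalanced maxA maxB A<B)
  ... | no noPair = inj₁ wc
    where
    wc : WellCovered G
    wc S T maxS maxT with <-cmp ∣ S ∣ ∣ T ∣
    ... | tri< S<T _ _ = contradiction (S , T , maxS , maxT , S<T) noPair
    ... | tri≈ _ S≡T _ = S≡T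
    ... | tri> _ _ T<S = contradiction (T , S , maxT , maxS , T<S) noPair

  -- p ∈ I is a star centre of I when every neighbour of p has a neighbour
  -- in I other than p: removing p from I leaves its neighbourhood dominated.
  -- This is what lets the product argument change a single row at p.
  StarCentre : Subset k → Fin k → Set
  StarCentre I p = ∀ u → Adj G p u → ∃[ q ] q ∈ I × q ≢ p × Adj G u q

  coveredAround? : ∀ I p u → Dec (Adj G p u → ∃[ q ] q ∈ I × q ≢ p × Adj G u q)
  coveredAround? I p u = Adj? p u →-dec any? λ q → (q ∈? I) ×-dec ¬? (q ≟ᶠ p) ×-dec Adj? u q

  starCentre? : ∀ I p → Dec (StarCentre I p)
  starCentre? I p = all? (coveredAround? I p)

  privateNeighbour : ∀ {I p} → ¬ StarCentre I p → ∃[ u ] Adj G p u × (∀ q → q ∈ I → q ≢ p → ¬ Adj G u q)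
  privateNeighbour {I} {p} notCentre with ¬∀⟶∃¬ k _ (coveredAround? I p) notCentre
  ... | u , notCovered with Adj? p u
  ...   | yes pu = u , pu , λ q q∈I q≢p uq → notCovered (λ _ → q , q∈I , q≢p , uq)
  ...   | no ¬pu = contradiction (λ pu → contradiction pu ¬pu) notCovered

  record Star : Set where
    constructor star
    field
      {I}        : Subset k
      {centre}   : Fin k
      I-maximal  : MaximalIndependent G I
      centre∈I   : centre ∈ I
      isCentre   : StarCentre I centre

  record DisjointUnbalanced : Set where
    constructor disjointUnbalanced
    field
      pair     : Unbalanced
      disjoint : ∀ {x} → x ∈ Unbalanced.small pair → x ∉ Unbalanced.large pair

  -- If s ∈ A ∩ B is not a star centre of B, replace s in B by
  -- a private neighbour u; the result extends to a maximal B′ at least as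
  -- large as B whose intersection with A is strictly smaller (it loses s and
  -- gains nothing, since every x ∈ A ─ B has a neighbour in B - s).
  exchange : ∀ {A B s} → MaximalIndependent G A → MaximalIndependent G B → s ∈ A → s ∈ B →
             ¬ StarCentre B s → ∃[ B′ ] MaximalIndependent G B′ × ∣ B ∣ ≤ ∣ B′ ∣ × A ∩ B′ ⊂ A ∩ B
  exchange {A} {B} {s} maxA maxB s∈A s∈B notCentre =
    B′ , maxB′ , B≤B′ , (A∩B′⊆A∩B , s , x∈p∩q⁺ (s∈A , s∈B) , s∉A∩B′)
    where
    u = proj₁ (privateNeighbour notCentre)
    su = proj₁ (proj₂ (privateNeighbour notCentre))
    private-u = proj₂ (proj₂ (privateNeighbour notCentre))

    u∉B : u ∉ B
    u∉B u∈B = proj₁ maxB s u s∈B u∈B su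

    B-s⊆B : B - s ⊆ B
    B-s⊆B = p─q⊆p B ⁅ s ⁆

    x∈B-s⇒x≢s : ∀ {x} → x ∈ B - s → x ≢ s
    x∈B-s⇒x≢s x∈B-s = x∉⁅y⁆⇒x≢y (x∈p─q⇒x∉q B ⁅ s ⁆ x∈B-s)

    B₂ = (B - s) ∪ ⁅ u ⁆

    indB₂ : Independent G B₂
    indB₂ = ∪-independent (independent-⊆ B-s⊆B (proj₁ maxB)) (independent-⁅⁆ u) noEdge
      where
      noEdge : ∀ x y → x ∈ B - s → y ∈ ⁅ u ⁆ → ¬ Adj G x y
      noEdge x y x∈B-s y∈⁅u⁆ xy with x∈⁅y⁆⇒x≡y u y∈⁅u⁆
      ... | refl = private-u x (B-s⊆B x∈B-s) (x∈B-s⇒x≢s x∈B-s) (adj-sym xy)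

    B′ = proj₁ (extend indB₂)
    maxB′ = proj₁ (proj₂ (extend indB₂))
    B₂⊆B′ = proj₂ (proj₂ (extend indB₂))

    -- B and B₂ have the same size: B = (B - s) ∪ ⁅ s ⁆ and B₂ = (B - s) ∪ ⁅ u ⁆.
    B≤B′ : ∣ B ∣ ≤ ∣ B′ ∣
    B≤B′ = begin
      ∣ B ∣                   ≤⟨ p⊆q⇒∣p∣≤∣q∣ B⊆B-s∪s ⟩
      ∣ (B - s) ∪ ⁅ s ⁆ ∣     ≡⟨ ∣p∪q∣≡∣p∣+∣q∣ (B - s) ⁅ s ⁆ (x∈p─q⇒x∉q B ⁅ s ⁆) ⟩
      ∣ B - s ∣ + ∣ ⁅ s ⁆ ∣   ≡⟨ cong (∣ B - s ∣ +_) (trans (∣⁅x⁆∣≡1 s) (≡-sym (∣⁅x⁆∣≡1 u))) ⟩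
      ∣ B - s ∣ + ∣ ⁅ u ⁆ ∣   ≡⟨ ∣p∪q∣≡∣p∣+∣q∣ (B - s) ⁅ u ⁆ B-s∌u ⟨
      ∣ B₂ ∣                  ≤⟨ p⊆q⇒∣p∣≤∣q∣ B₂⊆B′ ⟩
      ∣ B′ ∣                  ∎
      where
      open ≤-Reasoning
      B⊆B-s∪s : B ⊆ (B - s) ∪ ⁅ s ⁆
      B⊆B-s∪s {x} x∈B with x ≟ᶠ s
      ... | yes refl = x∈p∪q⁺ (inj₂ (x∈⁅x⁆ s))
      ... | no  x≢s  = x∈p∪q⁺ (inj₁ (x∈p∧x≢y⇒x∈p-y x∈B x≢s))
      B-s∌u : ∀ {x} → x ∈ B - s → x ∉ ⁅ u ⁆
      B-s∌u x∈B-s x∈⁅u⁆ = u∉B (subst (_∈ B) (x∈⁅y⁆⇒x≡y u x∈⁅u⁆) (B-s⊆B x∈B-s))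

    A∩B′⊆A∩B : A ∩ B′ ⊆ A ∩ B
    A∩B′⊆A∩B {x} x∈A∩B′ with x∈p∩q⁻ A B′ x∈A∩B′
    ... | x∈A , x∈B′ with maximal⇒covers maxB x
    ...   | inj₁ x∈B = x∈p∩q⁺ (x∈A , x∈B)
    ...   | inj₂ (y , y∈B , xy) with y ≟ᶠ s
    ...     | yes refl = contradiction xy (proj₁ maxA x s x∈A s∈A)
    ...     | no  y≢s  = contradiction xy
                           (proj₁ maxB′ x y x∈B′ (B₂⊆B′ (x∈p∪q⁺ (inj₁ (x∈p∧x≢y⇒x∈p-y y∈B y≢s)))))

    s∉A∩B′ : s ∉ A ∩ B′
    s∉A∩B′ s∈A∩B′ = proj₁ maxB′ s u (proj₂ (x∈p∩q⁻ A B′ s∈A∩B′)) (B₂⊆B′ (x∈p∪q⁺ (inj₂ (x∈⁅x⁆ u)))) su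

  descend : ∀ fuel {A B} → MaximalIndependent G A → MaximalIndependent G B → ∣ A ∣ < ∣ B ∣ →
            ∣ A ∩ B ∣ < fuel → Star ⊎ DisjointUnbalanced
  descend zero       _    _    _   ()
  descend (suc fuel) {A} {B} maxA maxB A<B bound with any? (λ x → x ∈? A ∩ B)
  ... | no  A∩B-empty = inj₂ (disjointUnbalanced (unbalanced maxA maxB A<B)
                                λ x∈A x∈B → A∩B-empty (_ , x∈p∩q⁺ (x∈A , x∈B)))
  ... | yes (s , s∈A∩B) with x∈p∩q⁻ A B s∈A∩B
  ...   | s∈A , s∈B with starCentre? B s
  ...     | yes centre    = inj₁ (star maxB s∈B centre)
  ...     | no  notCentre with exchange maxA maxB s∈A s∈B notCentre
  ...       | B′ , maxB′ , B≤B′ , shrinks =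
    descend fuel maxA maxB′ (<-≤-trans A<B B≤B′) (<-≤-trans (p⊂q⇒∣p∣<∣q∣ shrinks) (≤-pred bound))

  unbalanced⇒star⊎disjoint : Unbalanced → Star ⊎ DisjointUnbalanced
  unbalanced⇒star⊎disjoint (unbalanced {A} {B} maxA maxB A<B) =
    descend (suc k) maxA maxB A<B (s≤s (∣p∣≤n (A ∩ B)))

record ProductStructure {k n m} (K : Graph k) (G : Graph n) (H : Graph m) : Set where
  field
    π₁         : Fin k → Fin n
    π₂         : Fin k → Fin m
    pair       : Fin n → Fin m → Fin k
    π₁-pair    : ∀ g h → π₁ (pair g h) ≡ g
    π₂-pair    : ∀ g h → π₂ (pair g h) ≡ h
    edge⇒      : ∀ {u v} → Adj K u v →
                 (π₁ u ≡ π₁ v × Adj H (π₂ u) (π₂ v)) ⊎ (Adj G (π₁ u) (π₁ v) × π₂ u ≡ π₂ v)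
    vertical   : ∀ {u v} → π₁ u ≡ π₁ v → Adj H (π₂ u) (π₂ v) → Adj K u v
    horizontal : ∀ {u v} → Adj G (π₁ u) (π₁ v) → π₂ u ≡ π₂ v → Adj K u v
    count-rows : ∀ (F : Fin n → Fin m → Bool) → count (λ u → F (π₁ u) (π₂ u)) ≡ sum (λ g → count (F g))

transpose : ∀ {k n m} {K : Graph k} {G : Graph n} {H : Graph m} →
            ProductStructure K G H → ProductStructure K H G
transpose {G = G} {H = H} P = record
  { π₁         = π₂
  ; π₂         = π₁
  ; pair       = λ h g → pair g h
  ; π₁-pair    = λ h g → π₂-pair g h
  ; π₂-pair    = λ h g → π₁-pair g h
  ; edge⇒      = swapEdge ∘ edge⇒
  ; vertical   = λ same hh′ → horizontal hh′ same
  ; horizontal = λ gg′ same → vertical same gg′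
  ; count-rows = λ F → trans (count-rows (λ g h → F h g)) (∑-comm (λ g h → indicator (F h g)))
  }
  where
  open ProductStructure P
  swapEdge : ∀ {u v} → (π₁ u ≡ π₁ v × Adj H (π₂ u) (π₂ v)) ⊎ (Adj G (π₁ u) (π₁ v) × π₂ u ≡ π₂ v) →
             (π₂ u ≡ π₂ v × Adj G (π₁ u) (π₁ v)) ⊎ (Adj H (π₂ u) (π₂ v) × π₁ u ≡ π₁ v)
  swapEdge (inj₁ (same , hh′)) = inj₂ (hh′ , same)
  swapEdge (inj₂ (gg′ , same)) = inj₁ (same , gg′)

module _ where
  -- Defs keeps its equality test on Fin private; it is recovered here as the
  -- adjacency between (0 , x) and (1 , y) in the product of the edge K₂ with
  -- an edgeless graph, which reduces to exactly that test.
  private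
    K₂ : Graph 2
    adj K₂ zero       zero       = false
    adj K₂ zero       (suc zero) = true
    adj K₂ (suc zero) zero       = true
    adj K₂ (suc zero) (suc zero) = false
    sym K₂ zero       zero       = refl
    sym K₂ zero       (suc zero) = refl
    sym K₂ (suc zero) zero       = refl
    sym K₂ (suc zero) (suc zero) = refl
    irref K₂ zero       = refl
    irref K₂ (suc zero) = refl

    edgeless : ∀ m → Graph m
    adj   (edgeless m) _ _ = false
    sym   (edgeless m) _ _ = refl
    irref (edgeless m) _   = refl

    sameVertex : ∀ {m} → Fin m → Fin m → Bool
    sameVertex {m} x y = prodAdj' K₂ (edgeless m) (zero , x) (suc zero , y)

    sameVertex-refl : ∀ {m} (x : Fin m) → sameVertex x x ≡ true
    sameVertex-refl zero    = refl
    sameVertex-refl (suc x) = sameVertex-refl x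

    sameVertex⇒≡ : ∀ {m} {x y : Fin m} → sameVertex x y ≡ true → x ≡ y
    sameVertex⇒≡ {x = zero}  {zero}  _ = refl
    sameVertex⇒≡ {x = suc x} {suc y} e = cong suc (sameVertex⇒≡ e)

  module _ {n m} (G : Graph n) (H : Graph m) where
    private
      prodAdj′⇒ : ∀ {g g′ h h′} → prodAdj' G H (g , h) (g′ , h′) ≡ true →
                  (g ≡ g′ × Adj H h h′) ⊎ (Adj G g g′ × h ≡ h′)
      prodAdj′⇒ {g} {g′} {h} {h′} e
        with sameVertex g g′ in e₁ | adj H h h′ | adj G g g′ | sameVertex h h′ in e₄
      prodAdj′⇒ _  | true  | true  | _     | _     = inj₁ (sameVertex⇒≡ e₁ , refl)
      prodAdj′⇒ _  | _     | _     | true  | true  = inj₂ (refl , sameVertex⇒≡ e₄)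
      prodAdj′⇒ () | true  | false | false | _
      prodAdj′⇒ () | true  | false | true  | false
      prodAdj′⇒ () | false | _     | false | _
      prodAdj′⇒ () | false | _     | true  | false

      prodAdj′-vertical : ∀ {g g′ h h′} → g ≡ g′ → Adj H h h′ → prodAdj' G H (g , h) (g′ , h′) ≡ true
      prodAdj′-vertical {g} refl hh′ rewrite sameVertex-refl g | hh′ = refl

      prodAdj′-horizontal : ∀ {g g′ h h′} → Adj G g g′ → h ≡ h′ → prodAdj' G H (g , h) (g′ , h′) ≡ true
      prodAdj′-horizontal {g} {g′} {h} gg′ refl with sameVertex g g′
      ... | true  rewrite irref H h | gg′ | sameVertex-refl h = refl
      ... | false rewrite gg′ | sameVertex-refl h = refl

    cartesian : ProductStructure (G □ H) G H
    cartesian = record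
      { π₁         = λ u → proj₁ (remQuot {n} m u)
      ; π₂         = λ u → proj₂ (remQuot {n} m u)
      ; pair       = combine
      ; π₁-pair    = λ g h → cong proj₁ (remQuot-combine g h)
      ; π₂-pair    = λ g h → cong proj₂ (remQuot-combine g h)
      ; edge⇒      = prodAdj′⇒
      ; vertical   = prodAdj′-vertical
      ; horizontal = prodAdj′-horizontal
      ; count-rows = λ F → trans (count-combine n m _)
                       (sum-cong-≗ λ g → sum-cong-≗ λ h →
                          cong (λ gh → indicator (F (proj₁ gh) (proj₂ gh))) (remQuot-combine g h))
      }

module RowSets {k n m} {K : Graph k} {G : Graph n} {H : Graph m} (P : ProductStructure K G H) where
  open ProductStructure P

  rowSet : (Fin n → Subset m) → Subset k
  rowSet R = tabulate (λ u → lookup (R (π₁ u)) (π₂ u))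

  ∈rowSet⁻ : ∀ R {u} → u ∈ rowSet R → π₂ u ∈ R (π₁ u)
  ∈rowSet⁻ R {u} u∈ =
    lookup⇒[]= (π₂ u) (R (π₁ u)) (trans (≡-sym (lookup∘tabulate _ u)) ([]=⇒lookup u∈))

  ∈rowSet⁺ : ∀ R {u} → π₂ u ∈ R (π₁ u) → u ∈ rowSet R
  ∈rowSet⁺ R {u} h∈ = lookup⇒[]= u (rowSet R) (trans (lookup∘tabulate _ u) ([]=⇒lookup h∈))

  pair∈rowSet : ∀ R {g h} → h ∈ R g → pair g h ∈ rowSet R
  pair∈rowSet R {g} {h} h∈ =
    ∈rowSet⁺ R (subst₂ (λ g′ h′ → h′ ∈ R g′) (≡-sym (π₁-pair g h)) (≡-sym (π₂-pair g h)) h∈)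

  ∣rowSet∣ : ∀ R → ∣ rowSet R ∣ ≡ sum (λ g → ∣ R g ∣)
  ∣rowSet∣ R = begin
    ∣ rowSet R ∣                           ≡⟨ ∣tabulate∣ (λ u → lookup (R (π₁ u)) (π₂ u)) ⟩
    count (λ u → lookup (R (π₁ u)) (π₂ u)) ≡⟨ count-rows (λ g → lookup (R g)) ⟩
    sum (λ g → count (lookup (R g)))       ≡⟨ sum-cong-≗ (≡-sym ∘ ∣p∣≡count ∘ R) ⟩
    sum (λ g → ∣ R g ∣)                    ∎
    where open ≡-Reasoning

  rowSet-independent : ∀ R → (∀ g → Independent H (R g)) →
                       (∀ g g′ {h} → Adj G g g′ → h ∈ R g → h ∉ R g′) → Independent K (rowSet R)
  rowSet-independent R rowsInd adjDisjoint u v u∈ v∈ uv with edge⇒ uv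
  ... | inj₁ (same , hh′) =
    rowsInd (π₁ u) (π₂ u) (π₂ v) (∈rowSet⁻ R u∈) (subst (λ g → π₂ v ∈ R g) (≡-sym same) (∈rowSet⁻ R v∈)) hh′
  ... | inj₂ (gg′ , same) =
    adjDisjoint (π₁ u) (π₁ v) gg′ (∈rowSet⁻ R u∈) (subst (_∈ R (π₁ v)) (≡-sym same) (∈rowSet⁻ R v∈))

  maximalRow⇒covered : ∀ R v → MaximalIndependent H (R (π₁ v)) → Covered K (rowSet R) v
  maximalRow⇒covered R v maxRow with maximal⇒covers H maxRow (π₂ v)
  ... | inj₁ h∈ = inj₁ (∈rowSet⁺ R h∈)
  ... | inj₂ (h′ , h′∈ , hh′) =
    inj₂ (pair (π₁ v) h′ , pair∈rowSet R h′∈ ,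
          vertical (≡-sym (π₁-pair (π₁ v) h′)) (subst (Adj H (π₂ v)) (≡-sym (π₂-pair (π₁ v) h′)) hh′))

  neighbourRow⇒covered : ∀ R v {g} → Adj G (π₁ v) g → π₂ v ∈ R g → Covered K (rowSet R) v
  neighbourRow⇒covered R v {g} gg′ h∈ =
    inj₂ (pair g (π₂ v) , pair∈rowSet R h∈ ,
          horizontal (subst (Adj G (π₁ v)) (≡-sym (π₁-pair g (π₂ v))) gg′) (≡-sym (π₂-pair g (π₂ v))))

  rowDomination : ∀ R₁ R₂ → (∀ g {h} → h ∈ R₂ g → MaximalIndependent H (R₁ g)) →
                  (∀ g g′ {h} → Adj G g g′ → h ∈ R₂ g′ →
                     MaximalIndependent H (R₁ g) ⊎ ∃[ g″ ] Adj G g g″ × h ∈ R₁ g″) →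
                  ∀ v → Covered K (rowSet R₂) v → Covered K (rowSet R₁) v
  rowDomination R₁ R₂ maxOnSupport seen v (inj₁ v∈) =
    maximalRow⇒covered R₁ v (maxOnSupport (π₁ v) (∈rowSet⁻ R₂ v∈))
  rowDomination R₁ R₂ maxOnSupport seen v (inj₂ (z , z∈ , vz)) with edge⇒ vz
  ... | inj₁ (same , _) =
    maximalRow⇒covered R₁ v
      (subst (MaximalIndependent H ∘ R₁) (≡-sym same) (maxOnSupport (π₁ z) (∈rowSet⁻ R₂ z∈)))
  ... | inj₂ (gg′ , same) with seen (π₁ v) (π₁ z) gg′ (subst (_∈ R₂ (π₁ z)) (≡-sym same) (∈rowSet⁻ R₂ z∈))
  ...   | inj₁ maxRow            = maximalRow⇒covered R₁ v maxRow
  ...   | inj₂ (g″ , gg″ , h∈)   = neighbourRow⇒covered R₁ v gg″ h∈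

  block : Subset n → Subset n → Subset m → Subset m → Fin n → Subset m
  block A B r s g with g ∈? A | g ∈? B
  ... | yes _ | _     = r
  ... | no  _ | yes _ = s
  ... | no  _ | no  _ = ⊥

  module _ {A B : Subset n} {r s : Subset m} where

    data BlockView (g : Fin n) : Subset m → Set where
      inA     : g ∈ A → BlockView g r
      inB     : g ∉ A → g ∈ B → BlockView g s
      outside : g ∉ A → g ∉ B → BlockView g ⊥

    blockView : ∀ g → BlockView g (block A B r s g)
    blockView g with g ∈? A | g ∈? B
    ... | yes g∈A | _       = inA g∈A
    ... | no  g∉A | yes g∈B = inB g∉A g∈B
    ... | no  g∉A | no  g∉B = outside g∉A g∉B

    ∈block-A : ∀ {g h} → g ∈ A → h ∈ r → h ∈ block A B r s g
    ∈block-A {g} g∈A h∈r with block A B r s g | blockView g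
    ... | _ | inA _         = h∈r
    ... | _ | inB g∉A _     = contradiction g∈A g∉A
    ... | _ | outside g∉A _ = contradiction g∈A g∉A

    ∈block-B : ∀ {g h} → g ∉ A → g ∈ B → h ∈ s → h ∈ block A B r s g
    ∈block-B {g} g∉A g∈B h∈s with block A B r s g | blockView g
    ... | _ | inA g∈A       = contradiction g∈A g∉A
    ... | _ | inB _ _       = h∈s
    ... | _ | outside _ g∉B = contradiction g∈B g∉B

    block-support : ∀ {g h} → h ∈ block A B r s g → g ∈ A ⊎ g ∈ B
    block-support {g} h∈ with block A B r s g | blockView g
    ... | _ | inA g∈A       = inj₁ g∈A
    ... | _ | inB _ g∈B     = inj₂ g∈B
    ... | _ | outside _ _   = contradiction h∈ ∉⊥

    block-maximal : MaximalIndependent H r → MaximalIndependent H s →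
                    ∀ {g} → g ∈ A ⊎ g ∈ B → MaximalIndependent H (block A B r s g)
    block-maximal maxR maxS {g} g∈A∪B with block A B r s g | blockView g | g∈A∪B
    ... | _ | inA _          | _        = maxR
    ... | _ | inB _ _        | _        = maxS
    ... | _ | outside g∉A _  | inj₁ g∈A = contradiction g∈A g∉A
    ... | _ | outside _ g∉B  | inj₂ g∈B = contradiction g∈B g∉B

    block-independent : Independent H r → Independent H s → Independent G A → Independent G B →
                        (∀ {g g′ h} → g ∈ A → g′ ∈ B → Adj G g g′ → h ∈ r → h ∉ s) →
                        Independent K (rowSet (block A B r s))
    block-independent indR indS indA indB crossDisjoint =
      rowSet-independent (block A B r s) rowsIndependent adjDisjoint
      where
      rowsIndependent : ∀ g → Independent H (block A B r s g)
      rowsIndependent g with block A B r s g | blockView g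
      ... | _ | inA _       = indR
      ... | _ | inB _ _     = indS
      ... | _ | outside _ _ = λ x _ x∈⊥ → contradiction x∈⊥ ∉⊥

      adjDisjoint : ∀ g g′ {h} → Adj G g g′ → h ∈ block A B r s g → h ∉ block A B r s g′
      adjDisjoint g g′ gg′ h∈ h∈′ with block A B r s g | blockView g | block A B r s g′ | blockView g′
      ... | _ | inA g∈A     | _ | inA g′∈A     = indA g g′ g∈A g′∈A gg′
      ... | _ | inB _ g∈B   | _ | inB _ g′∈B   = indB g g′ g∈B g′∈B gg′
      ... | _ | inA g∈A     | _ | inB _ g′∈B   = crossDisjoint g∈A g′∈B gg′ h∈ h∈′
      ... | _ | inB _ g∈B   | _ | inA g′∈A     = crossDisjoint g′∈A g∈B (adj-sym G gg′) h∈′ h∈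
      ... | _ | outside _ _ | _ | _            = contradiction h∈ ∉⊥
      ... | _ | _           | _ | outside _ _  = contradiction h∈′ ∉⊥

    ∣rowSet-block∣ : (∀ {g} → g ∈ A → g ∉ B) → ∣ rowSet (block A B r s) ∣ ≡ ∣ A ∣ * ∣ r ∣ + ∣ B ∣ * ∣ s ∣
    ∣rowSet-block∣ disjoint = begin
      ∣ rowSet (block A B r s) ∣                       ≡⟨ ∣rowSet∣ (block A B r s) ⟩
      sum (λ g → ∣ block A B r s g ∣)                  ≡⟨ sum-cong-≗ rowSize ⟩
      sum (λ g → [A] g * ∣ r ∣ + [B] g * ∣ s ∣)
        ≡⟨ ∑-distrib-+ (λ g → [A] g * ∣ r ∣) (λ g → [B] g * ∣ s ∣) ⟩
      sum (λ g → [A] g * ∣ r ∣) + sum (λ g → [B] g * ∣ s ∣)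
        ≡⟨ cong₂ _+_ (*-distribʳ-sum ∣ r ∣ [A]) (*-distribʳ-sum ∣ s ∣ [B]) ⟨
      count (lookup A) * ∣ r ∣ + count (lookup B) * ∣ s ∣
        ≡⟨ cong₂ (λ a b → a * ∣ r ∣ + b * ∣ s ∣) (∣p∣≡count A) (∣p∣≡count B) ⟨
      ∣ A ∣ * ∣ r ∣ + ∣ B ∣ * ∣ s ∣                    ∎
      where
      open ≡-Reasoning
      [A] [B] : Fin n → ℕ
      [A] g = indicator (lookup A g)
      [B] g = indicator (lookup B g)
      rowSize : ∀ g → ∣ block A B r s g ∣ ≡ [A] g * ∣ r ∣ + [B] g * ∣ s ∣
      rowSize g with block A B r s g | blockView g
      ... | _ | inA g∈A rewrite []=⇒lookup g∈A | lookup-∉ (disjoint g∈A) =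
        ≡-sym (trans (+-identityʳ (∣ r ∣ + 0)) (+-identityʳ ∣ r ∣))
      ... | _ | inB g∉A g∈B rewrite lookup-∉ g∉A | []=⇒lookup g∈B = ≡-sym (+-identityʳ ∣ s ∣)
      ... | _ | outside g∉A g∉B rewrite lookup-∉ g∉A | lookup-∉ g∉B = ∣⊥∣≡0 m

  -- Z₁ carries C on row p and D on the other rows of I, Z₂
  -- carries D on all rows of I: Z₂ is larger, yet dominated by Z₁, because a
  -- G-neighbour of p sees D on some other row of I.
  star⇒notWellCovered : Star G → Unbalanced H → ¬ WellCovered K
  star⇒notWellCovered (star {I} {p} maxI p∈I centre) (unbalanced {C} {D} maxC maxD C<D) =
    dominationCriterion K (independent (proj₁ maxC)) (independent (proj₁ maxD)) dominated smaller
    where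
    A = ⁅ p ⁆
    B = I - p
    R₁ = block A B C D
    R₂ = block A B D D

    A⊆I : A ⊆ I
    A⊆I g∈A = subst (_∈ I) (≡-sym (x∈⁅y⁆⇒x≡y p g∈A)) p∈I

    B⊆I : B ⊆ I
    B⊆I = p─q⊆p I ⁅ p ⁆

    A∩B-empty : ∀ {g} → g ∈ A → g ∉ B
    A∩B-empty g∈A g∈B = x∈p─q⇒x∉q I ⁅ p ⁆ g∈B g∈A

    independent : ∀ {r} → Independent H r → Independent K (rowSet (block A B r D))
    independent indR = block-independent indR (proj₁ maxD) (independent-⁅⁆ G p)
                           (independent-⊆ G B⊆I (proj₁ maxI))
                           (λ g∈A g′∈B gg′ _ _ → proj₁ maxI _ _ (A⊆I g∈A) (B⊆I g′∈B) gg′)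

    smaller : ∣ rowSet R₁ ∣ < ∣ rowSet R₂ ∣
    smaller = begin-strict
      ∣ rowSet R₁ ∣                 ≡⟨ ∣rowSet-block∣ A∩B-empty ⟩
      ∣ A ∣ * ∣ C ∣ + ∣ B ∣ * ∣ D ∣ ≡⟨ cong (λ a → a * ∣ C ∣ + ∣ B ∣ * ∣ D ∣) (∣⁅x⁆∣≡1 p) ⟩
      1 * ∣ C ∣ + ∣ B ∣ * ∣ D ∣     <⟨ +-monoˡ-< (∣ B ∣ * ∣ D ∣) (*-monoʳ-< 1 C<D) ⟩
      1 * ∣ D ∣ + ∣ B ∣ * ∣ D ∣     ≡⟨ cong (λ a → a * ∣ D ∣ + ∣ B ∣ * ∣ D ∣) (∣⁅x⁆∣≡1 p) ⟨
      ∣ A ∣ * ∣ D ∣ + ∣ B ∣ * ∣ D ∣ ≡⟨ ∣rowSet-block∣ A∩B-empty ⟨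
      ∣ rowSet R₂ ∣                 ∎
      where open ≤-Reasoning

    seen : ∀ g g′ {h} → Adj G g g′ → h ∈ R₂ g′ → MaximalIndependent H (R₁ g) ⊎ ∃[ g″ ] Adj G g g″ × h ∈ R₁ g″
    seen g g′ gg′ h∈ with R₂ g′ | blockView {A} {B} {D} {D} g′
    ... | _ | inA g′∈A with x∈⁅y⁆⇒x≡y p g′∈A
    ...   | refl with centre g (adj-sym G gg′)
    ...     | q , q∈I , q≢p , gq = inj₂ (q , gq , ∈block-B (q≢p ∘ x∈⁅y⁆⇒x≡y p) (x∈p∧x≢y⇒x∈p-y q∈I q≢p) h∈)
    seen g g′ gg′ h∈ | _ | inB g′∉A g′∈B  = inj₂ (g′ , gg′ , ∈block-B g′∉A g′∈B h∈)
    seen g g′ gg′ h∈ | _ | outside _ _    = contradiction h∈ ∉⊥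

    dominated : ∀ v → Covered K (rowSet R₂) v → Covered K (rowSet R₁) v
    dominated = rowDomination R₁ R₂
                  (λ g h∈ → block-maximal maxC maxD (block-support {A} {B} {D} {D} {g} h∈)) seen

  -- Z₁ carries D on
  -- the rows of A and C on those of B, Z₂ the other way round; by the
  -- rearrangement inequality Z₂ is larger, and a vertex outside A ∪ B sees the
  -- needed row through its neighbours in the maximal sets A and B.
  disjoint⇒notWellCovered : DisjointUnbalanced G → DisjointUnbalanced H → ¬ WellCovered K
  disjoint⇒notWellCovered (disjointUnbalanced (unbalanced {A} {B} maxA maxB A<B) A∩B-empty)
                          (disjointUnbalanced (unbalanced {C} {D} maxC maxD C<D) C∩D-empty) =
    dominationCriterion K independent₁ independent₂ dominated smaller
    where
    R₁ = block A B D C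
    R₂ = block A B C D

    independent₁ : Independent K (rowSet R₁)
    independent₁ = block-independent (proj₁ maxD) (proj₁ maxC) (proj₁ maxA) (proj₁ maxB)
                     (λ _ _ _ h∈D h∈C → C∩D-empty h∈C h∈D)

    independent₂ : Independent K (rowSet R₂)
    independent₂ = block-independent (proj₁ maxC) (proj₁ maxD) (proj₁ maxA) (proj₁ maxB)
                     (λ _ _ _ → C∩D-empty)

    smaller : ∣ rowSet R₁ ∣ < ∣ rowSet R₂ ∣
    smaller = begin-strict
      ∣ rowSet R₁ ∣                 ≡⟨ ∣rowSet-block∣ A∩B-empty ⟩
      ∣ A ∣ * ∣ D ∣ + ∣ B ∣ * ∣ C ∣ <⟨ rearrangement A<B C<D ⟩
      ∣ A ∣ * ∣ C ∣ + ∣ B ∣ * ∣ D ∣ ≡⟨ ∣rowSet-block∣ A∩B-empty ⟨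
      ∣ rowSet R₂ ∣                 ∎
      where open ≤-Reasoning

    seen : ∀ g g′ {h} → Adj G g g′ → h ∈ R₂ g′ → MaximalIndependent H (R₁ g) ⊎ ∃[ g″ ] Adj G g g″ × h ∈ R₁ g″
    seen g g′ gg′ h∈ with R₁ g | blockView {A} {B} {D} {C} g
    ... | _ | inA _           = inj₁ maxD
    ... | _ | inB _ _         = inj₁ maxC
    ... | _ | outside g∉A g∉B with R₂ g′ | blockView {A} {B} {C} {D} g′
    ...   | _ | inA _ with maximal⇒covers G maxB g
    ...     | inj₁ g∈B            = contradiction g∈B g∉B
    ...     | inj₂ (y , y∈B , gy) = inj₂ (y , gy , ∈block-B (λ y∈A → A∩B-empty y∈A y∈B) y∈B h∈)
    seen g g′ gg′ h∈ | _ | outside g∉A _ | _ | inB _ _ with maximal⇒covers G maxA g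
    ...     | inj₁ g∈A            = contradiction g∈A g∉A
    ...     | inj₂ (y , y∈A , gy) = inj₂ (y , gy , ∈block-A y∈A h∈)
    seen g g′ gg′ h∈ | _ | outside _ _   | _ | outside _ _ = contradiction h∈ ∉⊥

    dominated : ∀ v → Covered K (rowSet R₂) v → Covered K (rowSet R₁) v
    dominated = rowDomination R₁ R₂
                  (λ g h∈ → block-maximal maxD maxC (block-support {A} {B} {C} {D} {g} h∈)) seen

-- A star in either factor together with
-- any unbalanced pair in the other, or disjoint pairs in both, contradicts
-- well-coveredness of G □ H.
theorem2 : ∀ {n m} (G : Graph n) (H : Graph m) → WellCovered (G □ H) → WellCovered G ⊎ WellCovered H
theorem2 G H wc with wellCovered⊎unbalanced G | wellCovered⊎unbalanced H
... | inj₁ wcG  | _         = inj₁ wcG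
... | inj₂ _    | inj₁ wcH  = inj₂ wcH
... | inj₂ unbG | inj₂ unbH with unbalanced⇒star⊎disjoint G unbG | unbalanced⇒star⊎disjoint H unbH
...   | inj₁ starG | _          = contradiction wc (RowSets.star⇒notWellCovered (cartesian G H) starG unbH)
...   | inj₂ _     | inj₁ starH =
  contradiction wc (RowSets.star⇒notWellCovered (transpose (cartesian G H)) starH unbG)
...   | inj₂ disjG | inj₂ disjH = contradiction wc (RowSets.disjoint⇒notWellCovered (cartesian G H) disjG disjH)
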